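{- Let $k\geq 2$ and let $U=\{u_0<u_1<\dots<u_{k-1}\}$ be a set of integers with $u_0=0$ and $u_1-u_0\leq u_{k-1}-u_{k-2}$, and let $W=\{u_j-u_i: 0\le i\le j\le k-1\}$. Then $u_{01}=u_1-u_0$ can be inferred from $W$: if $U'=\{u'_0<\dots<u'_{k-1}\}$ is any other $k$-element set of integers with $u'_0=0$, $u'_1-u'_0\le u'_{k-1}-u'_{k-2}$ and $\{u'_j-u'_i:0\le i\le j\le k-1\}=W$, then $u'_1-u'_0=u_1-u_0$.
   Context: Notation: $u_{ij}=u_j-u_i$ for $0\le i\le j\le k-1$; $W$ is the pairwise distance set of $U$. -}

module Defs where

open import Data.Nat using (ℕ; suc)
open import Data.Fin using (Fin; zero; suc; fromℕ; inject₁) renaming (_<_ to _<ᶠ_; _≤_ to _≤ᶠ_)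
open import Data.Integer using (ℤ; _-_; _<_; _≤_; 0ℤ)
open import Data.Product using (Σ; _×_; ∃)
open import Relation.Binary.PropositionalEquality using (_≡_)

-- A k-element integer set U = {u₀ < u₁ < … < u_{k-1}} given by its increasing enumeration.
StrictlyIncreasing : ∀ {k} → (Fin k → ℤ) → Set
StrictlyIncreasing {k} u = ∀ (i j : Fin k) → i <ᶠ j → u i < u j

InDist : ∀ {k} → (Fin k → ℤ) → ℤ → Set
InDist {k} u d = Σ (Fin k) λ i → Σ (Fin k) λ j → (i ≤ᶠ j) × (d ≡ u j - u i)

-- Hypotheses of the lemma for k = n + 2: u₀ = 0, strictly increasing,
-- and u₁ - u₀ ≤ u_{k-1} - u_{k-2}.
Admissible : ∀ n → (Fin (suc (suc n)) → ℤ) → Set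
Admissible n u =
  StrictlyIncreasing u ×
  (u zero ≡ 0ℤ) ×
  (u (suc zero) - u zero ≤ u (fromℕ (suc n)) - u (inject₁ (fromℕ n)))

module Submission where

-- The largest distance in W is the diameter u_{k-1} - u_0, and the largest
-- distance strictly below it is u_{k-1} - u_1: a pair starting at u_0 but not
-- ending at u_{k-1} spans at most u_{k-2} - u_0, which the hypothesis
-- u_{01} ≤ u_{k-2,k-1} bounds by u_{k-1} - u_1.  Both maxima are read off W,
-- so u_{01} is their difference.

open import Defs
open import Data.Nat as ℕ using (ℕ; suc; z≤n; s≤s)
open import Data.Fin using (Fin; zero; suc; fromℕ; inject₁; _≟_) renaming (_≤_ to _≤ᶠ_)
open import Data.Fin.Properties using (≤fromℕ; ≤∧≢⇒<)
open import Data.Integer using (ℤ; _+_; _-_; _≤_; _<_)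
open import Data.Integer.Properties
  using (≤-refl; ≤-trans; ≤-antisym; <⇒≤; <-irrefl; +-mono-≤; +-monoˡ-≤; +-monoʳ-<; neg-mono-≤; neg-mono-<)
open import Data.Integer.Tactic.RingSolver using (solve-∀)
open import Data.Product using (_×_; _,_; proj₁; proj₂)
open import Data.Empty using (⊥-elim)
open import Relation.Binary.PropositionalEquality using (_≡_; _≢_; refl; cong; cong₂; subst₂)
open import Relation.Nullary using (yes; no)
open import Level using (0ℓ)
open import Relation.Unary using (Pred; _⊆_; _≐_)

IsGreatest : Pred ℤ 0ℓ → ℤ → Set
IsGreatest P x = P x × (∀ {y} → P y → y ≤ x)

isGreatest-mono : ∀ {P Q : Pred ℤ 0ℓ} {x y} → P ⊆ Q → IsGreatest P x → IsGreatest Q y → x ≤ y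
isGreatest-mono P⊆Q (Px , _) (_ , Q≤y) = Q≤y (P⊆Q Px)

isGreatest-unique : ∀ {P Q : Pred ℤ 0ℓ} {x y} → P ≐ Q → IsGreatest P x → IsGreatest Q y → x ≡ y
isGreatest-unique (P⊆Q , Q⊆P) gP gQ = ≤-antisym (isGreatest-mono P⊆Q gP gQ) (isGreatest-mono Q⊆P gQ gP)

≐-restrict-< : ∀ {P Q : Pred ℤ 0ℓ} {x y} → P ≐ Q → x ≡ y → (λ d → P d × d < x) ≐ (λ d → Q d × d < y)
≐-restrict-< (P⊆Q , Q⊆P) refl = (λ (p , d<x) → P⊆Q p , d<x) , (λ (q , d<y) → Q⊆P q , d<y)

-‿mono-≤ : ∀ {a b c d} → a ≤ b → c ≤ d → a - d ≤ b - c
-‿mono-≤ a≤b c≤d = +-mono-≤ a≤b (neg-mono-≤ c≤d)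

-‿exchange-≤ : ∀ a b c d → a - b ≤ c - d → d - b ≤ c - a
-‿exchange-≤ a b c d ab≤cd = subst₂ _≤_ (lhs a b d) (rhs c d a) (+-monoˡ-≤ (d - a) ab≤cd)
  where
  lhs : ∀ a b d → (a - b) + (d - a) ≡ d - b
  lhs = solve-∀
  rhs : ∀ c d a → (c - d) + (d - a) ≡ c - a
  rhs = solve-∀

[m-n]-[m-o]≡o-n : ∀ m n o → (m - n) - (m - o) ≡ o - n
[m-n]-[m-o]≡o-n = solve-∀

≢fromℕ⇒≤inject₁fromℕ : ∀ {n} (j : Fin (suc (suc n))) → j ≢ fromℕ (suc n) → j ≤ᶠ inject₁ (fromℕ n)
≢fromℕ⇒≤inject₁fromℕ          zero       _   = z≤n
≢fromℕ⇒≤inject₁fromℕ {ℕ.zero} (suc zero) j≢1 = ⊥-elim (j≢1 refl)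
≢fromℕ⇒≤inject₁fromℕ {suc n}  (suc j)    j≢L = s≤s (≢fromℕ⇒≤inject₁fromℕ j (λ j≡L → j≢L (cong suc j≡L)))

strictlyIncreasing⇒monotone : ∀ {k} {u : Fin k → ℤ} → StrictlyIncreasing u →
                              ∀ {i j} → i ≤ᶠ j → u i ≤ u j
strictlyIncreasing⇒monotone inc {i} {j} i≤j with i ≟ j
... | yes refl = ≤-refl
... | no  i≢j  = <⇒≤ (inc i j (≤∧≢⇒< i≤j i≢j))

diameter : ∀ {k} → (Fin (suc k) → ℤ) → ℤ
diameter {k} u = u (fromℕ k) - u zero

diameter-isGreatest : ∀ {k} {u : Fin (suc k) → ℤ} → StrictlyIncreasing u →
                      IsGreatest (InDist u) (diameter u)
diameter-isGreatest {k} {u} inc = (zero , fromℕ k , z≤n , refl) , bound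
  where
  bound : InDist u ⊆ (_≤ diameter u)
  bound (i , j , _ , refl) = -‿mono-≤ (strictlyIncreasing⇒monotone inc (≤fromℕ j))
                                      (strictlyIncreasing⇒monotone inc z≤n)

secondDiameter : ∀ {n} → (Fin (suc (suc n)) → ℤ) → ℤ
secondDiameter {n} u = u (fromℕ (suc n)) - u (suc zero)

diameter-secondDiameter≡u₀₁ : ∀ {n} (u : Fin (suc (suc n)) → ℤ) →
                              diameter u - secondDiameter u ≡ u (suc zero) - u zero
diameter-secondDiameter≡u₀₁ {n} u = [m-n]-[m-o]≡o-n (u (fromℕ (suc n))) (u zero) (u (suc zero))

secondDiameter-isGreatest :
  ∀ {n} {u : Fin (suc (suc n)) → ℤ} → StrictlyIncreasing u →
  u (suc zero) - u zero ≤ u (fromℕ (suc n)) - u (inject₁ (fromℕ n)) →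
  IsGreatest (λ d → InDist u d × d < diameter u) (secondDiameter u)
secondDiameter-isGreatest {n} {u} inc u₀₁≤uₖ₋₂ₖ₋₁ =
  ((suc zero , fromℕ (suc n) , s≤s z≤n , refl) ,
   +-monoʳ-< (u (fromℕ (suc n))) (neg-mono-< (inc zero (suc zero) (s≤s z≤n)))) ,
  bound
  where
  mono = strictlyIncreasing⇒monotone inc
  bound : ∀ {d} → InDist u d × d < diameter u → d ≤ secondDiameter u
  bound ((zero , j , _ , refl) , d<D) with j ≟ fromℕ (suc n)
  ... | yes refl = ⊥-elim (<-irrefl refl d<D)
  ... | no  j≢L  = ≤-trans (-‿mono-≤ (mono (≢fromℕ⇒≤inject₁fromℕ j j≢L)) ≤-refl)
                           (-‿exchange-≤ (u (suc zero)) (u zero) (u (fromℕ (suc n))) (u (inject₁ (fromℕ n)))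
                                         u₀₁≤uₖ₋₂ₖ₋₁)
  bound ((suc i , j , _ , refl) , _) = -‿mono-≤ (mono (≤fromℕ j)) (mono (s≤s z≤n))

lemma1 : (n : ℕ) → (u u′ : Fin (suc (suc n)) → ℤ) →
    Admissible n u → Admissible n u′ →
    ((d : ℤ) → (InDist u d → InDist u′ d) × (InDist u′ d → InDist u d)) →
    u′ (suc zero) - u′ zero ≡ u (suc zero) - u zero
lemma1 n u u′ (inc , _ , u₀₁≤) (inc′ , _ , u′₀₁≤) sameW =
  subst₂ _≡_ (diameter-secondDiameter≡u₀₁ u′) (diameter-secondDiameter≡u₀₁ u) (cong₂ _-_ D′≡D second′≡second)
  where
  W′≐W : InDist u′ ≐ InDist u
  W′≐W = (λ {d} → proj₂ (sameW d)) , (λ {d} → proj₁ (sameW d))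

  D′≡D : diameter u′ ≡ diameter u
  D′≡D = isGreatest-unique W′≐W (diameter-isGreatest inc′) (diameter-isGreatest inc)

  second′≡second : secondDiameter u′ ≡ secondDiameter u
  second′≡second = isGreatest-unique (≐-restrict-< W′≐W D′≡D)
                     (secondDiameter-isGreatest inc′ u′₀₁≤) (secondDiameter-isGreatest inc u₀₁≤)
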